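{- For $u\in\mathbb{P}^*$, (1) $F(u;t,x)=\dfrac{(1-x)S(u;t,x)}{1-x-tx}$, and (2) $A(u;t,x)=\dfrac{1-x}{1-x-tx}-F(u;t,x)$.
   Context: $\mathbb{P}$ is the positive integers with the usual order; $\mathbb{P}^*$ is the set of finite words (compositions) over $\mathbb{P}$. Generalized factor order: $u\le w$ iff there is a factor $w'$ of $w$ (consecutive letters) with $|w'|=|u|$ and $u_i\le w'_i$ for all $i$; such $w'$ is an embedding. $\mathcal{F}(u)=\{w:w\ge u\}$; $\mathcal{S}(u)$ is the set of $w\in\mathcal{F}(u)$ for which every embedding of $u$ into $w$ is a suffix of $w$; $\mathcal{A}(u)=\{w:w\not\ge u\}$. The weight of $w=w_1\cdots w_\ell$ is $\mathrm{wt}(w)=t^{\ell}x^{w_1+\cdots+w_\ell}$, and $F(u;t,x),S(u;t,x),A(u;t,x)$ are the sums of $\mathrm{wt}(w)$ over $\mathcal{F}(u),\mathcal{S}(u),\mathcal{A}(u)$ respectively, as formal power series in commuting variables $t,x$. -}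

module Defs where

open import Data.Nat using (ℕ; zero; suc; _+_; _∸_; _≤_)
import Data.Nat.Properties as ℕP
open import Data.Integer as ℤ using (ℤ; +_; -_) renaming (_+_ to _+ℤ_; _*_ to _*ℤ_)
open import Data.List using (List; []; _∷_; [_]; length; drop; take; map; concatMap; filter; upTo; foldr)
open import Data.List.Relation.Binary.Pointwise as PW using (Pointwise)
open import Data.Fin using (Fin; toℕ)
open import Data.Fin.Properties using (any?; all?)
open import Data.Product using (Σ)
open import Relation.Binary.PropositionalEquality using (_≡_)
open import Relation.Nullary using (¬_; Dec; ¬?; _→-dec_)
open import Relation.Unary using (Pred; Decidable)
open import Level using (0ℓ)

-- Words over ℙ are lists of natural numbers (all letters ≥ 1 for words in ℙ*).
Word : Set
Word = List ℕ

-- u embeds into w at position i (0-based): the factor w' = w_{i+1} ... w_{i+|u|}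
-- of w has length |u| and u_k ≤ w'_k for all k.
-- (Pointwise forces the factor  take |u| (drop i w)  to have length exactly |u|.)
EmbedsAt : Word → Word → ℕ → Set
EmbedsAt u w i = Pointwise _≤_ u (take (length u) (drop i w))

_≼_ : Word → Word → Set
u ≼ w = Σ (Fin (suc (length w))) λ i → EmbedsAt u w (toℕ i)

InF : Word → Pred Word 0ℓ
InF u w = u ≼ w

InS : Word → Pred Word 0ℓ
InS u w = (u ≼ w) Data.Product.×
          ((i : Fin (suc (length w))) → EmbedsAt u w (toℕ i) → toℕ i + length u ≡ length w)

InA : Word → Pred Word 0ℓ
InA u w = ¬ (u ≼ w)

embedsAt? : (u w : Word) (i : ℕ) → Dec (EmbedsAt u w i)
embedsAt? u w i = PW.decidable ℕP._≤?_ u (take (length u) (drop i w))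

≼? : (u w : Word) → Dec (u ≼ w)
≼? u w = any? λ i → embedsAt? u w (toℕ i)

InF? : (u : Word) → Decidable (InF u)
InF? u w = ≼? u w

InS? : (u : Word) → Decidable (InS u)
InS? u w = ≼? u w Relation.Nullary.×-dec
           all? (λ i → embedsAt? u w (toℕ i) →-dec (toℕ i + length u ℕP.≟ length w))

InA? : (u : Word) → Decidable (InA u)
InA? u w = ¬? (≼? u w)

-- comps ℓ n : the list of all words in ℙ* of length ℓ with letter sum n
-- (first letter a+1 ranges over 1..n).
comps : ℕ → ℕ → List Word
comps zero zero = [ [] ]
comps zero (suc n) = []
comps (suc ℓ) n = concatMap (λ a → map (suc a ∷_) (comps ℓ (n ∸ suc a))) (upTo n)

-- Formal power series in commuting t, x with integer coefficients:
-- s ℓ n is the coefficient of t^ℓ x^n.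
Series : Set
Series = ℕ → ℕ → ℤ

-- Generating function Σ_{w ∈ ℙ*, P w} t^{|w|} x^{Σ w}:
-- coefficient of t^ℓ x^n = number of compositions of n with ℓ parts satisfying P.
GF : {P : Pred Word 0ℓ} → Decidable P → Series
GF P? ℓ n = + length (filter P? (comps ℓ n))

F S A : Word → Series
F u = GF (InF? u)
S u = GF (InS? u)
A u = GF (InA? u)

Σ< : ℕ → (ℕ → ℤ) → ℤ
Σ< n f = foldr (λ i acc → f i +ℤ acc) (+ 0) (upTo n)

_+ˢ_ : Series → Series → Series
(f +ˢ g) ℓ n = f ℓ n +ℤ g ℓ n

_*ˢ_ : Series → Series → Series
(f *ˢ g) ℓ n = Σ< (suc ℓ) λ i → Σ< (suc n) λ j → f i j *ℤ g (ℓ ∸ i) (n ∸ j)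

_≈ˢ_ : Series → Series → Set
f ≈ˢ g = ∀ ℓ n → f ℓ n ≡ g ℓ n

oneMinusX : Series
oneMinusX zero zero = + 1
oneMinusX zero (suc zero) = - (+ 1)
oneMinusX _ _ = + 0

oneMinusXMinusTX : Series
oneMinusXMinusTX zero zero = + 1
oneMinusXMinusTX zero (suc zero) = - (+ 1)
oneMinusXMinusTX (suc zero) (suc zero) = - (+ 1)
oneMinusXMinusTX _ _ = + 0

-- A word p c with last letter c has an embedding of u that is not a suffix iff u ≤ p.  Writing
-- G(u) for these words, F = S + G, and counting the words of G(u) by whether their last letter is
-- 1 (delete it) or at least 2 (lower it) gives (1 − x) G = t x F; hence (1 − x − t x) F = (1 − x) S.
-- The same last-letter count gives (1 − x − t x) C = 1 − x for the series C of all compositions,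
-- and C = A + F.
module Submission where

open import Defs
open import Data.Nat using (ℕ; zero; suc; _+_; _∸_; _⊓_; _≤_; _<_; s≤s; s≤s⁻¹)
open import Data.Nat.Properties
  using (+-identityʳ; +-comm; +-suc; +-commutativeSemigroup; _≟_; +-monoʳ-≤; m⊓n≤n; m+[n∸m]≡n;
         ≤∧≢⇒<; <⇒≢; m+n≤o⇒m≤o; n≤1+n; ≤-trans; n≤0⇒n≡0; module ≤-Reasoning)
open import Algebra.Properties.CommutativeSemigroup +-commutativeSemigroup using (interchange)
open import Data.List using (List; []; _∷_; [_]; _++_; _∷ʳ_; length; filter; map; concat; concatMap; applyUpTo; upTo; take; drop; foldr)
open import Data.List.Properties
  using (length-++; length-take; length-drop; filter-++; filter-reject; foldr-cong; map-upTo; concatMap-map; map-concatMap; map-∘; map-cong)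
open import Data.List.Relation.Unary.All using (All)
open import Data.List.Relation.Binary.Pointwise using (Pointwise; Pointwise-length)
open import Data.Fin using (Fin; toℕ; fromℕ<)
open import Data.Fin.Properties using (all?; toℕ≤pred[n]; toℕ-fromℕ<; ¬∀⟶∃¬)
open import Data.Product using (Σ; _×_; _,_; proj₁; proj₂)
open import Data.Integer using (ℤ; +_; -_) renaming (_+_ to _+ℤ_; _*_ to _*ℤ_; _-_ to _-ℤ_)
import Data.Integer.Properties as ℤP
open import Data.Integer.Solver using (module +-*-Solver)
open import Function using (_∘_; id; _⇔_; mk⇔; Equivalence)
open import Level using (Level; 0ℓ; _⊔_)
open import Relation.Binary.PropositionalEquality hiding ([_])
open import Relation.Nullary using (yes; no; ¬_; contradiction; _→-dec_)
open import Relation.Unary using (Pred; Decidable; _∩_; ∁)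
open import Relation.Unary.Properties using (_∩?_; ∁?; U?)

private
  variable
    a p q : Level
    B : Set a

count : {P : Pred B p} → Decidable P → List B → ℕ
count P? xs = length (filter P? xs)

count-U : (xs : List B) → count U? xs ≡ length xs
count-U [] = refl
count-U (x ∷ xs) = cong suc (count-U xs)

module _ {P : Pred B p} (P? : Decidable P) where

  count-++ : ∀ xs ys → count P? (xs ++ ys) ≡ count P? xs + count P? ys
  count-++ xs ys = trans (cong length (filter-++ P? xs ys)) (length-++ (filter P? xs))

  count-map : ∀ {C : Set a} (f : C → B) xs → count P? (map f xs) ≡ count (P? ∘ f) xs
  count-map f [] = refl
  count-map f (x ∷ xs) with P? (f x)
  ... | yes _ = cong suc (count-map f xs)
  ... | no  _ = count-map f xs

  count-∁ : ∀ xs → count P? xs + count (∁? P?) xs ≡ length xs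
  count-∁ [] = refl
  count-∁ (x ∷ xs) with P? x
  ... | yes _ = cong suc (count-∁ xs)
  ... | no  _ = trans (+-suc (count P? xs) _) (cong suc (count-∁ xs))

  count-∩-∁ : {Q : Pred B q} (Q? : Decidable Q) → ∀ xs →
              count P? xs ≡ count (P? ∩? Q?) xs + count (P? ∩? ∁? Q?) xs
  count-∩-∁ Q? [] = refl
  count-∩-∁ Q? (x ∷ xs) with P? x | Q? x
  ... | yes _ | yes _ = cong suc (count-∩-∁ Q? xs)
  ... | yes _ | no  _ = trans (cong suc (count-∩-∁ Q? xs)) (sym (+-suc _ _))
  ... | no  _ | _     = count-∩-∁ Q? xs

count-[-]-⇔ : {P : Pred B p} {Q : Pred B q} (P? : Decidable P) (Q? : Decidable Q) {x y : B} →
              P x ⇔ Q y → count P? [ x ] ≡ count Q? [ y ]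
count-[-]-⇔ P? Q? {x} {y} P⇔Q with P? x | Q? y
... | yes _  | yes _  = refl
... | no  _  | no  _  = refl
... | yes px | no ¬qy = contradiction (Equivalence.to P⇔Q px) ¬qy
... | no ¬px | yes qy = contradiction (Equivalence.from P⇔Q qy) ¬px

-- Raises the first letter; the value on [] is junk and never used.
incHead : Word → Word
incHead []      = []
incHead (a ∷ w) = suc a ∷ w

comps-suc-suc : ∀ ℓ n → comps (suc ℓ) (suc n) ≡ map (1 ∷_) (comps ℓ n) ++ map incHead (comps (suc ℓ) n)
comps-suc-suc ℓ n = cong (map (1 ∷_) (comps ℓ n) ++_) (begin
  concatMap part (applyUpTo suc n)          ≡⟨ cong (concatMap part) (map-upTo suc n) ⟨
  concatMap part (map suc (upTo n))         ≡⟨ concatMap-map part suc (upTo n) ⟩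
  concatMap (part ∘ suc) (upTo n)           ≡⟨ cong concat (map-cong (λ a → map-∘ (comps ℓ (n ∸ suc a))) (upTo n)) ⟩
  concatMap (map incHead ∘ part′) (upTo n)  ≡⟨ map-concatMap incHead part′ (upTo n) ⟨
  map incHead (concatMap part′ (upTo n))    ∎)
  where
  open ≡-Reasoning
  part part′ : ℕ → List Word
  part a  = map (suc a ∷_) (comps ℓ (suc n ∸ suc a))
  part′ a = map (suc a ∷_) (comps ℓ (n ∸ suc a))

count-comps-suc-suc : {P : Pred Word p} (P? : Decidable P) → ∀ ℓ n →
  count P? (comps (suc ℓ) (suc n)) ≡ count (P? ∘ (1 ∷_)) (comps ℓ n) + count (P? ∘ incHead) (comps (suc ℓ) n)
count-comps-suc-suc P? ℓ n = begin
  count P? (comps (suc ℓ) (suc n))                                      ≡⟨ cong (count P?) (comps-suc-suc ℓ n) ⟩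
  count P? (map (1 ∷_) (comps ℓ n) ++ map incHead (comps (suc ℓ) n))    ≡⟨ count-++ P? (map (1 ∷_) (comps ℓ n)) _ ⟩
  count P? (map (1 ∷_) (comps ℓ n)) + count P? (map incHead (comps (suc ℓ) n))
    ≡⟨ cong₂ _+_ (count-map P? (1 ∷_) (comps ℓ n)) (count-map P? incHead (comps (suc ℓ) n)) ⟩
  count (P? ∘ (1 ∷_)) (comps ℓ n) + count (P? ∘ incHead) (comps (suc ℓ) n) ∎
  where open ≡-Reasoning

comps-one : ∀ n → comps 1 (suc n) ≡ [ [ suc n ] ]
comps-one zero    = refl
comps-one (suc n) = trans (comps-suc-suc 0 (suc n)) (cong (map incHead) (comps-one n))

InitDetermined : Pred Word p → Pred Word q → Set (p ⊔ q)
InitDetermined P Q = ∀ w c → P (w ∷ʳ c) ⇔ Q w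

InitDetermined-∘incHead : {P : Pred Word p} {Q : Pred Word q} →
  InitDetermined P Q → InitDetermined (P ∘ incHead) (Q ∘ incHead)
InitDetermined-∘incHead P~Q []      c = P~Q [] (suc c)
InitDetermined-∘incHead P~Q (a ∷ w) c = P~Q (suc a ∷ w) c

-- comps recurses on the first letter, so the induction carries all pairs (P, Q) along at once.
count-comps-snoc : {P : Pred Word p} {Q : Pred Word q} (P? : Decidable P) (Q? : Decidable Q) →
  InitDetermined P Q → ∀ ℓ n →
  count P? (comps (suc ℓ) (suc n)) ≡ count P? (comps (suc ℓ) n) + count Q? (comps ℓ n)
count-comps-snoc P? Q? P~Q zero zero = count-[-]-⇔ P? Q? (P~Q [] 1)
count-comps-snoc P? Q? P~Q zero (suc n) rewrite comps-one (suc n) | comps-one n =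
  trans (trans (count-[-]-⇔ P? Q? (P~Q [] (suc (suc n)))) (sym (count-[-]-⇔ P? Q? (P~Q [] (suc n)))))
        (sym (+-identityʳ _))
count-comps-snoc P? Q? P~Q (suc ℓ) zero = refl
count-comps-snoc {P = P} {Q} P? Q? P~Q (suc ℓ) (suc n) = begin
  count P? (comps (2 + ℓ) (2 + n))
    ≡⟨ count-comps-suc-suc P? (suc ℓ) (suc n) ⟩
  count P₁? (comps (suc ℓ) (suc n)) + count P₊? (comps (2 + ℓ) (suc n))
    ≡⟨ cong₂ _+_ (count-comps-snoc P₁? Q₁? (λ w → P~Q (1 ∷ w)) ℓ n)
                 (count-comps-snoc P₊? Q₊? (InitDetermined-∘incHead {P = P} {Q} P~Q) (suc ℓ) n) ⟩
  (count P₁? (comps (suc ℓ) n) + count Q₁? (comps ℓ n)) + (count P₊? (comps (2 + ℓ) n) + count Q₊? (comps (suc ℓ) n))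
    ≡⟨ interchange (count P₁? (comps (suc ℓ) n)) _ _ _ ⟩
  (count P₁? (comps (suc ℓ) n) + count P₊? (comps (2 + ℓ) n)) + (count Q₁? (comps ℓ n) + count Q₊? (comps (suc ℓ) n))
    ≡⟨ cong₂ _+_ (count-comps-suc-suc P? (suc ℓ) n) (count-comps-suc-suc Q? ℓ n) ⟨
  count P? (comps (2 + ℓ) (suc n)) + count Q? (comps (suc ℓ) (suc n)) ∎
  where
  open ≡-Reasoning
  P₁? : Decidable (P ∘ (1 ∷_))
  P₁? = P? ∘ (1 ∷_)
  Q₁? : Decidable (Q ∘ (1 ∷_))
  Q₁? = Q? ∘ (1 ∷_)
  P₊? : Decidable (P ∘ incHead)
  P₊? = P? ∘ incHead
  Q₊? : Decidable (Q ∘ incHead)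
  Q₊? = Q? ∘ incHead

take-drop-++ˡ : ∀ k i (xs ys : List B) → i + k ≤ length xs → take k (drop i (xs ++ ys)) ≡ take k (drop i xs)
take-drop-++ˡ zero    zero    xs       ys _        = refl
take-drop-++ˡ (suc k) zero    (x ∷ xs) ys (s≤s le) = cong (x ∷_) (take-drop-++ˡ k zero xs ys le)
take-drop-++ˡ k       (suc i) (x ∷ xs) ys (s≤s le) = take-drop-++ˡ k i xs ys le

embedsAt-fits : ∀ u w i → i ≤ length w → EmbedsAt u w i → i + length u ≤ length w
embedsAt-fits u w i i≤∣w∣ E = begin
  i + length u                               ≡⟨ cong (_+_ i) (Pointwise-length E) ⟩
  i + length (take (length u) (drop i w))    ≡⟨ cong (_+_ i) (length-take (length u) (drop i w)) ⟩
  i + (length u ⊓ length (drop i w))         ≤⟨ +-monoʳ-≤ i (m⊓n≤n (length u) _) ⟩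
  i + length (drop i w)                      ≡⟨ cong (_+_ i) (length-drop i w) ⟩
  i + (length w ∸ i)                         ≡⟨ m+[n∸m]≡n i≤∣w∣ ⟩
  length w                                   ∎
  where open ≤-Reasoning

embedsAt-++ˡ : ∀ u p q i → i + length u ≤ length p → EmbedsAt u (p ++ q) i ⇔ EmbedsAt u p i
embedsAt-++ˡ u p q i fits = mk⇔ (subst (Pointwise _≤_ u) factor≡) (subst (Pointwise _≤_ u) (sym factor≡))
  where factor≡ = take-drop-++ˡ (length u) i p q fits

≼-at : ∀ {u w} i → i ≤ length w → EmbedsAt u w i → u ≼ w
≼-at {u} {w} i i≤∣w∣ E = fromℕ< (s≤s i≤∣w∣) , subst (EmbedsAt u w) (sym (toℕ-fromℕ< (s≤s i≤∣w∣))) E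

EmbeddingsAreSuffixes : Word → Pred Word 0ℓ
EmbeddingsAreSuffixes u w = (i : Fin (suc (length w))) → EmbedsAt u w (toℕ i) → toℕ i + length u ≡ length w

embeddingsAreSuffixes? : (u : Word) → Decidable (EmbeddingsAreSuffixes u)
embeddingsAreSuffixes? u w = all? λ i → embedsAt? u w (toℕ i) →-dec (toℕ i + length u ≟ length w)

EmbedsNonSuffix : Word → Pred Word 0ℓ
EmbedsNonSuffix u = InF u ∩ ∁ (EmbeddingsAreSuffixes u)

embedsNonSuffix? : (u : Word) → Decidable (EmbedsNonSuffix u)
embedsNonSuffix? u = InF? u ∩? ∁? (embeddingsAreSuffixes? u)

suffix-at : ∀ {u w} i → i ≤ length w → EmbeddingsAreSuffixes u w → EmbedsAt u w i → i + length u ≡ length w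
suffix-at {u} {w} i i≤∣w∣ suffixes E =
  subst (λ j → j + length u ≡ length w) (toℕ-fromℕ< (s≤s i≤∣w∣)) (suffixes (proj₁ emb) (proj₂ emb))
  where emb = ≼-at i i≤∣w∣ E

non-suffix-embedding : ∀ u w → ¬ EmbeddingsAreSuffixes u w →
  Σ (Fin (suc (length w))) λ i → EmbedsAt u w (toℕ i) × toℕ i + length u ≢ length w
non-suffix-embedding u w ¬suffixes with ¬∀⟶∃¬ _ _ (λ i → embedsAt? u w (toℕ i) →-dec (toℕ i + length u ≟ length w)) ¬suffixes
... | i , ¬suffix with embedsAt? u w (toℕ i)
...   | yes E = i , E , λ eq → ¬suffix (λ _ → eq)
...   | no ¬E = contradiction (λ E → contradiction E ¬E) ¬suffix

embeddingsAreSuffixes-[] : ∀ u → EmbeddingsAreSuffixes u []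
embeddingsAreSuffixes-[] u i E = n≤0⇒n≡0 (embedsAt-fits u [] (toℕ i) (toℕ≤pred[n] i) E)

embedsNonSuffix-snoc : ∀ u → InitDetermined (EmbedsNonSuffix u) (u ≼_)
embedsNonSuffix-snoc u p c = mk⇔ shorten extend
  where
  ∣pc∣≡ : length (p ∷ʳ c) ≡ suc (length p)
  ∣pc∣≡ = trans (length-++ p) (+-comm (length p) 1)

  shorten : EmbedsNonSuffix u (p ∷ʳ c) → u ≼ p
  shorten (_ , ¬suffixes) with non-suffix-embedding u (p ∷ʳ c) ¬suffixes
  ... | i , E , ¬suffix = ≼-at (toℕ i) (m+n≤o⇒m≤o (toℕ i) fits) (Equivalence.to (embedsAt-++ˡ u p [ c ] (toℕ i) fits) E)
    where
    fits : toℕ i + length u ≤ length p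
    fits = s≤s⁻¹ (subst (toℕ i + length u <_) ∣pc∣≡
             (≤∧≢⇒< (embedsAt-fits u (p ∷ʳ c) (toℕ i) (toℕ≤pred[n] i) E) ¬suffix))

  extend : u ≼ p → EmbedsNonSuffix u (p ∷ʳ c)
  extend (i , E) = ≼-at (toℕ i) i≤∣pc∣ E′ , λ suffixes → <⇒≢ (s≤s fits) (trans (suffix-at (toℕ i) i≤∣pc∣ suffixes E′) ∣pc∣≡)
    where
    fits : toℕ i + length u ≤ length p
    fits = embedsAt-fits u p (toℕ i) (toℕ≤pred[n] i) E
    i≤∣pc∣ : toℕ i ≤ length (p ∷ʳ c)
    i≤∣pc∣ = ≤-trans (toℕ≤pred[n] i) (subst (length p ≤_) (sym ∣pc∣≡) (n≤1+n _))
    E′ : EmbedsAt u (p ∷ʳ c) (toℕ i)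
    E′ = Equivalence.from (embedsAt-++ˡ u p [ c ] (toℕ i) fits) E

shift : (ℕ → ℤ) → ℕ → ℤ
shift h zero    = + 0
shift h (suc n) = h n

x·_ : Series → Series
(x· g) ℓ = shift (g ℓ)

t·_ : Series → Series
(t· g) ℓ n = shift (λ k → g k n) ℓ

Σ-applyUpTo-zero : (f : ℕ → ℤ) (g : ℕ → ℕ) → (∀ k → f (g k) ≡ + 0) → ∀ n →
  foldr (λ i acc → f i +ℤ acc) (+ 0) (applyUpTo g n) ≡ + 0
Σ-applyUpTo-zero f g f∘g≡0 zero    = refl
Σ-applyUpTo-zero f g f∘g≡0 (suc n) = cong₂ _+ℤ_ (f∘g≡0 0) (Σ-applyUpTo-zero f (g ∘ suc) (f∘g≡0 ∘ suc) n)

Σ<-zero : ∀ n (f : ℕ → ℤ) → (∀ i → f i ≡ + 0) → Σ< n f ≡ + 0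
Σ<-zero n f f≡0 = Σ-applyUpTo-zero f id f≡0 n

Σ<-convolution-two : (φ : ℕ → ℕ → ℤ) → (∀ i k → φ (2 + i) k ≡ + 0) → ∀ n →
  Σ< (suc n) (λ i → φ i (n ∸ i)) ≡ φ 0 n +ℤ shift (φ 1) n
Σ<-convolution-two φ φ₂≡0 zero    = refl
Σ<-convolution-two φ φ₂≡0 (suc n) = trans
  (cong (λ rest → φ 0 (suc n) +ℤ (φ 1 n +ℤ rest))
        (Σ-applyUpTo-zero (λ i → φ i (suc n ∸ i)) (suc ∘ suc) (λ k → φ₂≡0 k (n ∸ suc k)) n))
  (cong (φ 0 (suc n) +ℤ_) (ℤP.+-identityʳ (φ 1 n)))

shift-* : ∀ a h n → shift (λ k → a *ℤ h k) n ≡ a *ℤ shift h n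
shift-* a h zero    = sym (ℤP.*-zeroʳ a)
shift-* a h (suc n) = refl

shift-+ : ∀ f h n → shift (λ k → f k +ℤ h k) n ≡ shift f n +ℤ shift h n
shift-+ f h zero    = refl
shift-+ f h (suc n) = refl

shift-cong : ∀ {f h} → (∀ k → f k ≡ h k) → ∀ n → shift f n ≡ shift h n
shift-cong f≡h zero    = refl
shift-cong f≡h (suc n) = f≡h n

*ˢ-multiaffine : ∀ c g → (∀ i j → c i (2 + j) ≡ + 0) → (∀ i j → c (2 + i) j ≡ + 0) → ∀ ℓ n →
  (c *ˢ g) ℓ n ≡ (c 0 0 *ℤ g ℓ n +ℤ c 0 1 *ℤ (x· g) ℓ n) +ℤ (c 1 0 *ℤ (t· g) ℓ n +ℤ c 1 1 *ℤ (t· x· g) ℓ n)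
*ˢ-multiaffine c g c·₂≡0 c₂·≡0 ℓ n = begin
  Σ< (suc ℓ) (λ i → row i (ℓ ∸ i))    ≡⟨ Σ<-convolution-two row row₂≡0 ℓ ⟩
  row 0 ℓ +ℤ shift (row 1) ℓ          ≡⟨ cong₂ _+ℤ_ (row≡ 0 ℓ) (shift-cong (row≡ 1) ℓ) ⟩
  rowᵃ 0 ℓ +ℤ shift (rowᵃ 1) ℓ        ≡⟨ cong (rowᵃ 0 ℓ +ℤ_) (shift-+ (λ k → c 1 0 *ℤ g k n) _ ℓ) ⟩
  rowᵃ 0 ℓ +ℤ (shift (λ k → c 1 0 *ℤ g k n) ℓ +ℤ shift (λ k → c 1 1 *ℤ (x· g) k n) ℓ)
    ≡⟨ cong (rowᵃ 0 ℓ +ℤ_) (cong₂ _+ℤ_ (shift-* (c 1 0) (λ k → g k n) ℓ) (shift-* (c 1 1) (λ k → (x· g) k n) ℓ)) ⟩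
  rowᵃ 0 ℓ +ℤ (c 1 0 *ℤ (t· g) ℓ n +ℤ c 1 1 *ℤ (t· x· g) ℓ n) ∎
  where
  open ≡-Reasoning
  row : ℕ → ℕ → ℤ
  row i k = Σ< (suc n) (λ j → c i j *ℤ g k (n ∸ j))
  rowᵃ : ℕ → ℕ → ℤ
  rowᵃ i k = c i 0 *ℤ g k n +ℤ c i 1 *ℤ (x· g) k n
  row₂≡0 : ∀ i k → row (2 + i) k ≡ + 0
  row₂≡0 i k = Σ<-zero (suc n) _ (λ j → cong (_*ℤ g k (n ∸ j)) (c₂·≡0 i j))
  row≡ : ∀ i k → row i k ≡ rowᵃ i k
  row≡ i k = trans (Σ<-convolution-two (λ j m → c i j *ℤ g k m) (λ j m → cong (_*ℤ g k m) (c·₂≡0 i j)) n)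
                   (cong (c i 0 *ℤ g k n +ℤ_) (shift-* (c i 1) (g k) n))

oneMinusX-*ˢ : ∀ g ℓ n → (oneMinusX *ˢ g) ℓ n ≡ g ℓ n -ℤ (x· g) ℓ n
oneMinusX-*ˢ g ℓ n = trans
  (*ˢ-multiaffine oneMinusX g (λ { zero j → refl ; (suc i) j → refl }) (λ _ _ → refl) ℓ n)
  (solve 4 (λ a b c d → (con (+ 1) :* a :+ con (- + 1) :* b) :+ (con (+ 0) :* c :+ con (+ 0) :* d) := a :- b)
         refl (g ℓ n) ((x· g) ℓ n) ((t· g) ℓ n) ((t· x· g) ℓ n))
  where open +-*-Solver

oneMinusXMinusTX-*ˢ : ∀ g ℓ n → (oneMinusXMinusTX *ˢ g) ℓ n ≡ g ℓ n -ℤ (x· g) ℓ n -ℤ (t· x· g) ℓ n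
oneMinusXMinusTX-*ˢ g ℓ n = trans
  (*ˢ-multiaffine oneMinusXMinusTX g (λ { zero j → refl ; (suc zero) j → refl ; (suc (suc i)) j → refl }) (λ _ _ → refl) ℓ n)
  (solve 4 (λ a b c d → (con (+ 1) :* a :+ con (- + 1) :* b) :+ (con (+ 0) :* c :+ con (- + 1) :* d) := a :- b :- d)
         refl (g ℓ n) ((x· g) ℓ n) ((t· g) ℓ n) ((t· x· g) ℓ n))
  where open +-*-Solver

+[m+n]-m≡n : ∀ m n → + (m + n) -ℤ + m ≡ + n
+[m+n]-m≡n m n = trans (cong (_-ℤ + m) (ℤP.pos-+ m n)) (solve 2 (λ a b → (a :+ b) :- a := b) refl (+ m) (+ n))
  where open +-*-Solver

GF-snoc : {P : Pred Word 0ℓ} {Q : Pred Word 0ℓ} (P? : Decidable P) (Q? : Decidable Q) →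
  InitDetermined P Q → ∀ ℓ n → GF P? (suc ℓ) n -ℤ (x· GF P?) (suc ℓ) n ≡ (x· GF Q?) ℓ n
GF-snoc P? Q? P~Q ℓ zero    = refl
GF-snoc P? Q? P~Q ℓ (suc n) =
  trans (cong (λ k → + k -ℤ + count P? (comps (suc ℓ) n)) (count-comps-snoc P? Q? P~Q ℓ n))
        (+[m+n]-m≡n (count P? (comps (suc ℓ) n)) (count Q? (comps ℓ n)))

Σ<-cong : ∀ n {f g : ℕ → ℤ} → (∀ i → f i ≡ g i) → Σ< n f ≡ Σ< n g
Σ<-cong n f≗g = foldr-cong (λ i acc → cong (_+ℤ acc) (f≗g i)) refl (upTo n)

*ˢ-congʳ : ∀ c {f g} → f ≈ˢ g → (c *ˢ f) ≈ˢ (c *ˢ g)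
*ˢ-congʳ c f≈g ℓ n = Σ<-cong (suc ℓ) λ i → Σ<-cong (suc n) λ j → cong (c i j *ℤ_) (f≈g (ℓ ∸ i) (n ∸ j))

oneMinusXMinusTX*f≈oneMinusX*s : ∀ {f s g} → f ≈ˢ (s +ˢ g) →
  (∀ ℓ n → g ℓ n -ℤ (x· g) ℓ n ≡ (t· x· f) ℓ n) → (oneMinusXMinusTX *ˢ f) ≈ˢ (oneMinusX *ˢ s)
oneMinusXMinusTX*f≈oneMinusX*s {f} {s} {g} f≈s+g g-x·g≡t·x·f ℓ n = begin
  (oneMinusXMinusTX *ˢ f) ℓ n                         ≡⟨ oneMinusXMinusTX-*ˢ f ℓ n ⟩
  f ℓ n -ℤ (x· f) ℓ n -ℤ (t· x· f) ℓ n
    ≡⟨ cong₂ (λ a b → a -ℤ b -ℤ (t· x· f) ℓ n) (f≈s+g ℓ n) (trans (shift-cong (f≈s+g ℓ) n) (shift-+ (s ℓ) (g ℓ) n)) ⟩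
  (s ℓ n +ℤ g ℓ n) -ℤ ((x· s) ℓ n +ℤ (x· g) ℓ n) -ℤ (t· x· f) ℓ n
    ≡⟨ cong (λ c → (s ℓ n +ℤ g ℓ n) -ℤ ((x· s) ℓ n +ℤ (x· g) ℓ n) -ℤ c) (g-x·g≡t·x·f ℓ n) ⟨
  (s ℓ n +ℤ g ℓ n) -ℤ ((x· s) ℓ n +ℤ (x· g) ℓ n) -ℤ (g ℓ n -ℤ (x· g) ℓ n)
    ≡⟨ solve 4 (λ a b c d → (a :+ b) :- (c :+ d) :- (b :- d) := a :- c) refl (s ℓ n) (g ℓ n) ((x· s) ℓ n) ((x· g) ℓ n) ⟩
  s ℓ n -ℤ (x· s) ℓ n                                ≡⟨ oneMinusX-*ˢ s ℓ n ⟨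
  (oneMinusX *ˢ s) ℓ n                                ∎
  where
  open ≡-Reasoning
  open +-*-Solver

G : Word → Series
G u = GF (embedsNonSuffix? u)

F≈S+G : ∀ u → F u ≈ˢ (S u +ˢ G u)
F≈S+G u ℓ n = trans (cong +_ (count-∩-∁ (InF? u) (embeddingsAreSuffixes? u) ws))
                    (ℤP.pos-+ (count (InS? u) ws) (count (embedsNonSuffix? u) ws))
  where ws = comps ℓ n

G-row-zero : ∀ u n → G u 0 n ≡ + 0
G-row-zero u zero    = cong (λ ws → + length ws) (filter-reject (embedsNonSuffix? u) (λ (_ , ¬suffixes) → ¬suffixes (embeddingsAreSuffixes-[] u)))
G-row-zero u (suc n) = refl

G-x·G≡t·x·F : ∀ u ℓ n → G u ℓ n -ℤ (x· G u) ℓ n ≡ (t· x· F u) ℓ n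
G-x·G≡t·x·F u zero    zero    = cong (_-ℤ + 0) (G-row-zero u 0)
G-x·G≡t·x·F u zero    (suc n) = cong₂ _-ℤ_ (G-row-zero u (suc n)) (G-row-zero u n)
G-x·G≡t·x·F u (suc ℓ) n       = GF-snoc (embedsNonSuffix? u) (InF? u) (embedsNonSuffix-snoc u) ℓ n

Compositions : Series
Compositions = GF (U? {A = Word})

A+F≈Compositions : ∀ u → (A u +ˢ F u) ≈ˢ Compositions
A+F≈Compositions u ℓ n = begin
  + count (InA? u) ws +ℤ + count (InF? u) ws     ≡⟨ ℤP.pos-+ (count (InA? u) ws) (count (InF? u) ws) ⟨
  + (count (InA? u) ws + count (InF? u) ws)     ≡⟨ cong +_ (trans (+-comm (count (InA? u) ws) _) (count-∁ (InF? u) ws)) ⟩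
  + length ws                                   ≡⟨ cong +_ (count-U ws) ⟨
  Compositions ℓ n                              ∎
  where
  open ≡-Reasoning
  ws = comps ℓ n

oneMinusXMinusTX*Compositions≈oneMinusX : (oneMinusXMinusTX *ˢ Compositions) ≈ˢ oneMinusX
oneMinusXMinusTX*Compositions≈oneMinusX ℓ n = trans (oneMinusXMinusTX-*ˢ Compositions ℓ n) (rows ℓ n)
  where
  rows : ∀ ℓ n → Compositions ℓ n -ℤ (x· Compositions) ℓ n -ℤ (t· x· Compositions) ℓ n ≡ oneMinusX ℓ n
  rows zero    zero          = refl
  rows zero    (suc zero)    = refl
  rows zero    (suc (suc n)) = refl
  rows (suc ℓ) n             =
    trans (cong (_-ℤ (x· Compositions) ℓ n) (GF-snoc U? U? (λ _ _ → mk⇔ id id) ℓ n))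
          (ℤP.+-inverseʳ ((x· Compositions) ℓ n))

corollary3p1 : (u : List ℕ) → All (1 ≤_) u →
    ((oneMinusXMinusTX *ˢ F u) ≈ˢ (oneMinusX *ˢ S u))
    × ((oneMinusXMinusTX *ˢ (A u +ˢ F u)) ≈ˢ oneMinusX)
corollary3p1 u _ =
    oneMinusXMinusTX*f≈oneMinusX*s {F u} {S u} {G u} (F≈S+G u) (G-x·G≡t·x·F u)
  , λ ℓ n → trans (*ˢ-congʳ oneMinusXMinusTX (A+F≈Compositions u) ℓ n) (oneMinusXMinusTX*Compositions≈oneMinusX ℓ n)
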